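{- Let $K_{3,3}$ have vertices $A,B,C,D,E,F$ with bipartition $\{A,D,F\}$, $\{B,C,E\}$. For a 2-cell embedding of $K_{3,3}$ on the double torus, contracting the edges $AC, AE, BD, BF$ yields an embedding of $\Theta_5$ with vertices $CAE$ and $DBF$ and edges labelled $AB, CD, CF, ED, EF$. Let $\Theta_5^{\#2}$ be the embedding of $\Theta_5$ with vertices $u,v$, edges $1,\dots,5$ and rotation system $u:(1,2,3,4,5)$, $v:(1,2,3,4,5)$. Then there is no 2-cell embedding of $K_{3,3}$ on the double torus whose contracted embedding is isomorphic to $\Theta_5^{\#2}$.
   Context: $\Theta_5$ is the multigraph with two vertices and five parallel edges. A 2-cell embedding on the double torus (orientable surface of genus 2) has all faces homeomorphic to open discs and is described by a rotation system (for each vertex, a cyclic ordering of its incident edges). Two embeddings are isomorphic if a permutation of vertices and edges (preserving incidence) transforms one rotation system into the other. Contraction of an edge in an embedding merges its ends, combining their rotations. -}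

module Defs where

open import Data.Nat using (ℕ; zero; suc; _+_; _*_; _≡ᵇ_; _≤ᵇ_)
open import Data.Bool using (Bool; true; false; if_then_else_)
open import Data.Fin using (Fin; zero; suc)
open import Data.Fin as Fin using ()
open import Data.Maybe using (Maybe; just; nothing)
open import Data.List using (List; []; _∷_; _++_; map; mapMaybe; length; filterᵇ; upTo)
open import Data.Bool using (_∧_)
open import Data.Product using (Σ; _×_; _,_; proj₁; proj₂; ∃)
open import Relation.Binary.PropositionalEquality using (_≡_)
open import Data.List.Relation.Binary.Permutation.Propositional using (_↭_)
open import Function.Bundles using (_↔_; Inverse)

data V : Set where
  A B C D E F : V

data Edge : Set where
  AB AC AE BD BF CD CF ED EF : Edge

ends : Edge → V × V
ends AB = A , B
ends AC = A , C
ends AE = A , E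
ends BD = D , B
ends BF = F , B
ends CD = D , C
ends CF = F , C
ends ED = D , E
ends EF = F , E

incident : V → List Edge
incident A = AB ∷ AC ∷ AE ∷ []
incident B = AB ∷ BD ∷ BF ∷ []
incident C = AC ∷ CD ∷ CF ∷ []
incident D = BD ∷ CD ∷ ED ∷ []
incident E = AE ∷ ED ∷ EF ∷ []
incident F = BF ∷ CF ∷ EF ∷ []

vcode : V → ℕ
vcode A = 0
vcode B = 1
vcode C = 2
vcode D = 3
vcode E = 4
vcode F = 5

ecode : Edge → ℕ
ecode AB = 0
ecode AC = 1
ecode AE = 2
ecode BD = 3
ecode BF = 4
ecode CD = 5
ecode CF = 6
ecode ED = 7
ecode EF = 8

_==E_ : Edge → Edge → Bool
x ==E y = ecode x ≡ᵇ ecode y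

_==V_ : V → V → Bool
x ==V y = vcode x ≡ᵇ vcode y

-- Rotation systems.  A cyclic ordering of the edges at a vertex is
-- represented by a list (read cyclically); it must be a permutation of
-- the incident edges.

Rot : Set
Rot = V → List Edge

ValidRot : Rot → Set
ValidRot rot = (x : V) → rot x ↭ incident x

nextIn : List Edge → Edge → Edge
nextIn xs e = go xs
  where
  headOr : List Edge → Edge
  headOr []      = e
  headOr (y ∷ _) = y
  first : Edge
  first = headOr xs
  go : List Edge → Edge
  go []           = e
  go (y ∷ [])     = first
  go (y ∷ z ∷ ys) = if y ==E e then z else go (z ∷ ys)

-- Face tracing.  A dart is an edge with a direction
-- (true: from fst (ends e) to snd (ends e); false: reverse).

Dart : Set
Dart = Edge × Bool

tailD headD : Dart → V
tailD (e , true)  = proj₁ (ends e)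
tailD (e , false) = proj₂ (ends e)
headD (e , true)  = proj₂ (ends e)
headD (e , false) = proj₁ (ends e)

leaving : V → Edge → Dart
leaving x e = e , (proj₁ (ends e) ==V x)

faceStep : Rot → Dart → Dart
faceStep rot d = leaving (headD d) (nextIn (rot (headD d)) (proj₁ d))

iter : ℕ → (Dart → Dart) → Dart → Dart
iter zero    f d = d
iter (suc k) f d = f (iter k f d)

allDarts : List Dart
allDarts = concatE (AB ∷ AC ∷ AE ∷ BD ∷ BF ∷ CD ∷ CF ∷ ED ∷ EF ∷ [])
  where
  concatE : List Edge → List Dart
  concatE []       = []
  concatE (e ∷ es) = (e , true) ∷ (e , false) ∷ concatE es

dcode : Dart → ℕ
dcode (e , true)  = 2 * ecode e
dcode (e , false) = suc (2 * ecode e)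

allB : (ℕ → Bool) → List ℕ → Bool
allB p []       = true
allB p (k ∷ ks) = p k ∧ allB p ks

-- d is the (code-)minimal dart of its face-orbit (orbits have length ≤ 18)
orbitMin : Rot → Dart → Bool
orbitMin rot d = allB (λ k → dcode d ≤ᵇ dcode (iter k (faceStep rot) d)) (upTo 18)

faces : Rot → ℕ
faces rot = length (filterᵇ (orbitMin rot) allDarts)

-- The rotation system gives a 2-cell embedding in the orientable surface
-- of genus g determined by Euler's formula  |V| - |E| + |F| = 2 - 2g.
-- Double torus: g = 2 (written without subtraction).
TwoCellOnDoubleTorus : Rot → Set
TwoCellOnDoubleTorus rot = 6 + faces rot + 2 * 2 ≡ 9 + 2

-- elements of xs after e, read cyclically, e removed:
-- if xs = pre ++ e ∷ post then cutAt e xs = post ++ pre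
cutAt : Edge → List Edge → List Edge
cutAt e xs = go [] xs
  where
  go : List Edge → List Edge → List Edge
  go pre []       = pre
  go pre (y ∷ ys) = if y ==E e then ys ++ pre else go (pre ++ (y ∷ [])) ys

-- contracting the edge e joining vertices with rotations xs and ys:
-- (e a1..ak) and (e b1..bm) merge into (a1..ak b1..bm)
merge : Edge → List Edge → List Edge → List Edge
merge e xs ys = cutAt e xs ++ cutAt e ys

data ThV : Set where
  CAE DBF : ThV

data ThE : Set where
  tAB tCD tCF tED tEF : ThE

label : Edge → Maybe ThE
label AB = just tAB
label CD = just tCD
label CF = just tCF
label ED = just tED
label EF = just tEF
label _  = nothing

contract : Rot → ThV → List ThE
contract rot CAE = mapMaybe label (merge AE (merge AC (rot A) (rot C)) (rot E))
contract rot DBF = mapMaybe label (merge BF (merge BD (rot B) (rot D)) (rot F))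

rotateL : {X : Set} → ℕ → List X → List X
rotateL zero    xs       = xs
rotateL (suc k) []       = []
rotateL (suc k) (x ∷ xs) = rotateL k (xs ++ (x ∷ []))

CycEq : {X : Set} → List X → List X → Set
CycEq xs ys = ∃ λ k → rotateL k xs ≡ ys

-- Every edge of Theta_5 joins its two vertices, so any pair of
-- bijections preserves incidence.
IsoΘ : {V₁ E₁ V₂ E₂ : Set} → (V₁ → List E₁) → (V₂ → List E₂) → Set
IsoΘ {V₁} {E₁} {V₂} {E₂} r₁ r₂ =
  Σ (V₁ ↔ V₂) λ φ → Σ (E₁ ↔ E₂) λ ψ →
    (x : V₁) → CycEq (map (Inverse.to ψ) (r₁ x)) (r₂ (Inverse.to φ x))

-- Theta_5^{#2}: vertices u, v; edges 1..5 (as Fin 5: 0..4);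
-- rotation u : (1,2,3,4,5), v : (1,2,3,4,5).
data UV : Set where
  u v : UV

theta5-2 : UV → List (Fin 5)
theta5-2 _ = Fin.zero ∷ Fin.suc Fin.zero ∷ Fin.suc (Fin.suc Fin.zero)
           ∷ Fin.suc (Fin.suc (Fin.suc Fin.zero))
           ∷ Fin.suc (Fin.suc (Fin.suc (Fin.suc Fin.zero))) ∷ []

module Submission where

-- A vertex of degree three has only two cyclic orders of its edges, and face
-- tracing and contraction see a rotation only up to cyclic shift.  So every
-- rotation system of K₃,₃ behaves like one of the 2⁶ standard systems given by
-- an orientation of each vertex.  Both vertices of Θ₅^{#2} carry the same cyclic
-- sequence, so an isomorphism onto it makes the two contracted rotations cyclic
-- shifts of one another; evaluating the 64 standard systems shows that none with
-- a single face (genus two, by Euler's formula) has this property.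

open import Defs
open import Data.Nat using (ℕ; zero; suc; _+_; _*_; _<_; _≤ᵇ_; z<s; NonZero)
open import Data.Nat.Properties using (+-comm; m<n⇒m<1+n; anyUpTo?; ≡ᵇ⇒≡; ≡⇒≡ᵇ; _≟_; eq?)
open import Data.Nat.DivMod using (_%_; _/_; m≡m%n+[m/n]*n; m%n<n)
open import Data.Bool using (Bool; true; false; _∧_)
open import Data.Bool.Properties using (T-≡; ¬-not)
open import Data.List using (List; []; _∷_; _++_; [_]; length; map; reverse; filterᵇ; mapMaybe; upTo)
open import Data.List.Properties using (++-assoc; ++-identityʳ; map-++; map-injective; ≡-dec)
open import Data.List.Membership.Propositional using (_∈_)
open import Data.List.Relation.Unary.Any using (here; there)
open import Data.List.Relation.Binary.Permutation.Propositional using (_↭_; prep; swap; ↭-refl; ↭-sym)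
open import Data.List.Relation.Binary.Permutation.Propositional.Properties
  using (↭-length; ∈-resp-↭; drop-mid; ↭-singleton-inv)
open import Data.Maybe using (just)
open import Data.Maybe.Properties using (just-injective)
open import Data.Product using (∃; ∃₂; _×_; _,_; proj₁; proj₂)
open import Data.Sum using (_⊎_; inj₁; inj₂)
open import Function using (_∘_; Equivalence)
open import Function.Bundles using (Inverse; Injection; mk↣)
open import Function.Properties.Inverse using (↔⇒↣)
open import Relation.Binary.Definitions using (DecidableEquality)
open import Relation.Nullary using (¬_)
open import Relation.Nullary.Decidable using (Dec; map′; _×-dec_; ¬?; from-yes)
open import Relation.Binary.PropositionalEquality
  using (_≡_; _≢_; refl; sym; trans; cong; cong₂; subst₂; ≢-sym; module ≡-Reasoning)

private variable
  S T : Set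

rotateL-[] : ∀ k → rotateL {S} k [] ≡ []
rotateL-[] zero    = refl
rotateL-[] (suc k) = refl

rotateL-+ : ∀ m n (xs : List S) → rotateL (m + n) xs ≡ rotateL n (rotateL m xs)
rotateL-+ zero    n xs       = refl
rotateL-+ (suc m) n []       = sym (rotateL-[] n)
rotateL-+ (suc m) n (x ∷ xs) = rotateL-+ m n (xs ++ [ x ])

rotateL-++ : ∀ (xs ys : List S) → rotateL (length xs) (xs ++ ys) ≡ ys ++ xs
rotateL-++ []       ys = sym (++-identityʳ ys)
rotateL-++ (x ∷ xs) ys = begin
  rotateL (length xs) ((xs ++ ys) ++ [ x ])  ≡⟨ cong (rotateL (length xs)) (++-assoc xs ys [ x ]) ⟩
  rotateL (length xs) (xs ++ (ys ++ [ x ]))  ≡⟨ rotateL-++ xs (ys ++ [ x ]) ⟩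
  (ys ++ [ x ]) ++ xs                        ≡⟨ ++-assoc ys [ x ] xs ⟩
  ys ++ x ∷ xs                               ∎
  where open ≡-Reasoning

rotateL-length : ∀ (xs : List S) → rotateL (length xs) xs ≡ xs
rotateL-length xs = trans (cong (rotateL (length xs)) (sym (++-identityʳ xs))) (rotateL-++ xs [])

rotateL-*length : ∀ q (xs : List S) → rotateL (q * length xs) xs ≡ xs
rotateL-*length zero    xs = refl
rotateL-*length (suc q) xs = begin
  rotateL (length xs + q * length xs) xs          ≡⟨ rotateL-+ (length xs) (q * length xs) xs ⟩
  rotateL (q * length xs) (rotateL (length xs) xs) ≡⟨ cong (rotateL (q * length xs)) (rotateL-length xs) ⟩
  rotateL (q * length xs) xs                       ≡⟨ rotateL-*length q xs ⟩
  xs                                               ∎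
  where open ≡-Reasoning

rotateL-% : ∀ (xs : List S) k .{{_ : NonZero (length xs)}} →
            rotateL k xs ≡ rotateL (k % length xs) xs
rotateL-% xs k = begin
  rotateL k xs                                          ≡⟨ cong (λ m → rotateL m xs) k≡q*n+r ⟩
  rotateL (q * n + k % n) xs                            ≡⟨ rotateL-+ (q * n) (k % n) xs ⟩
  rotateL (k % n) (rotateL (q * n) xs)                  ≡⟨ cong (rotateL (k % n)) (rotateL-*length q xs) ⟩
  rotateL (k % n) xs                                    ∎
  where
  open ≡-Reasoning
  n = length xs
  q = k / n
  k≡q*n+r : k ≡ q * n + k % n
  k≡q*n+r = trans (m≡m%n+[m/n]*n k n) (+-comm (k % n) (q * n))

rotateL-bounded : ∀ (xs : List S) k → ∃ λ i → i < suc (length xs) × rotateL k xs ≡ rotateL i xs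
rotateL-bounded []       k = 0 , z<s , rotateL-[] k
rotateL-bounded (x ∷ xs) k =
  k % length (x ∷ xs) , m<n⇒m<1+n (m%n<n k (length (x ∷ xs))) , rotateL-% (x ∷ xs) k

rotateL-map : ∀ (f : S → T) k xs → rotateL k (map f xs) ≡ map f (rotateL k xs)
rotateL-map f zero    xs       = refl
rotateL-map f (suc k) []       = refl
rotateL-map f (suc k) (x ∷ xs) = trans (cong (rotateL k) (sym (map-++ f xs [ x ]))) (rotateL-map f k (xs ++ [ x ]))

CommonRotation : List S → List S → Set
CommonRotation xs ys = ∃₂ λ k j → rotateL k xs ≡ rotateL j ys

commonRotation? : DecidableEquality S → (xs ys : List S) → Dec (CommonRotation xs ys)
commonRotation? _≟_ xs ys =
  map′ (λ (k , _ , j , _ , eq) → k , j , eq) bounded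
       (anyUpTo? (λ k → anyUpTo? (λ j → ≡-dec _≟_ (rotateL k xs) (rotateL j ys)) (suc (length ys)))
                 (suc (length xs)))
  where
  bounded : CommonRotation xs ys →
            ∃ λ k → k < suc (length xs) × ∃ λ j → j < suc (length ys) × rotateL k xs ≡ rotateL j ys
  bounded (k , j , eq) with rotateL-bounded xs k | rotateL-bounded ys j
  ... | k′ , k′< , eqk | j′ , j′< , eqj = k′ , k′< , j′ , j′< , trans (sym eqk) (trans eq eqj)

reverseCyclic : List S → List S
reverseCyclic []       = []
reverseCyclic (x ∷ xs) = x ∷ reverse xs

oriented : Bool → List S → List S
oriented true  xs = xs
oriented false xs = reverseCyclic xs

↭-pair-inv : {xs : List S} {b c : S} → xs ↭ b ∷ c ∷ [] → xs ≡ b ∷ c ∷ [] ⊎ xs ≡ c ∷ b ∷ []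
↭-pair-inv {xs = q ∷ r ∷ []} p with ∈-resp-↭ (↭-sym p) (here refl)
... | here refl
  with refl ← ↭-singleton-inv (drop-mid [] [] p) = inj₁ refl
... | there (here refl)
  with refl ← ↭-singleton-inv (drop-mid [ q ] [] p) = inj₂ refl
↭-pair-inv {xs = []}            p with ↭-length p
... | ()
↭-pair-inv {xs = _ ∷ []}        p with ↭-length p
... | ()
↭-pair-inv {xs = _ ∷ _ ∷ _ ∷ _} p with ↭-length p
... | ()

↭-triple-inv : {xs : List S} {a b c : S} → xs ↭ a ∷ b ∷ c ∷ [] →
               ∃₂ λ o k → xs ≡ rotateL k (oriented o (a ∷ b ∷ c ∷ []))
↭-triple-inv {xs = q ∷ r ∷ s ∷ []} p with ∈-resp-↭ (↭-sym p) (here refl)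
... | here refl with ↭-pair-inv (drop-mid [] [] p)
...   | inj₁ refl = true , 0 , refl
...   | inj₂ refl = false , 0 , refl
↭-triple-inv {xs = q ∷ r ∷ s ∷ []} p | there (here refl) with ↭-pair-inv (drop-mid [ q ] [] p)
...   | inj₁ refl = false , 2 , refl
...   | inj₂ refl = true , 2 , refl
↭-triple-inv {xs = q ∷ r ∷ s ∷ []} p | there (there (here refl)) with ↭-pair-inv (drop-mid (q ∷ r ∷ []) [] p)
...   | inj₁ refl = true , 1 , refl
...   | inj₂ refl = false , 1 , refl
↭-triple-inv {xs = []}                p with ↭-length p
... | ()
↭-triple-inv {xs = _ ∷ []}            p with ↭-length p
... | ()
↭-triple-inv {xs = _ ∷ _ ∷ []}        p with ↭-length p
... | ()
↭-triple-inv {xs = _ ∷ _ ∷ _ ∷ _ ∷ _} p with ↭-length p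
... | ()

decode : ℕ → Edge
decode 0 = AB
decode 1 = AC
decode 2 = AE
decode 3 = BD
decode 4 = BF
decode 5 = CD
decode 6 = CF
decode 7 = ED
decode _ = EF

decode-ecode : ∀ e → decode (ecode e) ≡ e
decode-ecode AB = refl
decode-ecode AC = refl
decode-ecode AE = refl
decode-ecode BD = refl
decode-ecode BF = refl
decode-ecode CD = refl
decode-ecode CF = refl
decode-ecode ED = refl
decode-ecode EF = refl

ecode-injective : ∀ {e f} → ecode e ≡ ecode f → e ≡ f
ecode-injective {e} {f} eq = trans (sym (decode-ecode e)) (trans (cong decode eq) (decode-ecode f))

==E-refl : ∀ e → e ==E e ≡ true
==E-refl e = Equivalence.to T-≡ (≡⇒≡ᵇ (ecode e) (ecode e) refl)

==E-≢ : ∀ {e f} → e ≢ f → e ==E f ≡ false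
==E-≢ {e} {f} e≢f = ¬-not λ e==f → e≢f (ecode-injective (≡ᵇ⇒≡ (ecode e) (ecode f) (Equivalence.from T-≡ e==f)))

Distinct : Edge → Edge → Edge → Set
Distinct a b c = a ≢ b × b ≢ c × c ≢ a

record InCyclicOrder (a b c : Edge) (L : List Edge) : Set where
  field
    next-a : nextIn L a ≡ b
    next-b : nextIn L b ≡ c
    next-c : nextIn L c ≡ a
    cut-a  : cutAt a L ≡ b ∷ c ∷ []
    cut-b  : cutAt b L ≡ c ∷ a ∷ []
    cut-c  : cutAt c L ≡ a ∷ b ∷ []

inCyclicOrder-rotate : ∀ {a b c L} → InCyclicOrder a b c L → InCyclicOrder b c a L
inCyclicOrder-rotate o = record
  { next-a = next-b ; next-b = next-c ; next-c = next-a
  ; cut-a = cut-b ; cut-b = cut-c ; cut-c = cut-a }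
  where open InCyclicOrder o

triple-inCyclicOrder : ∀ {a b c} → Distinct a b c → InCyclicOrder a b c (a ∷ b ∷ c ∷ [])
triple-inCyclicOrder {a} {b} {c} (a≢b , b≢c , c≢a) = record
  { next-a = next-a ; next-b = next-b ; next-c = next-c
  ; cut-a = cut-a ; cut-b = cut-b ; cut-c = cut-c }
  where
  L = a ∷ b ∷ c ∷ []
  next-a : nextIn L a ≡ b
  next-a rewrite ==E-refl a = refl
  next-b : nextIn L b ≡ c
  next-b rewrite ==E-≢ a≢b | ==E-refl b = refl
  next-c : nextIn L c ≡ a
  next-c rewrite ==E-≢ (≢-sym c≢a) | ==E-≢ b≢c = refl
  cut-a : cutAt a L ≡ b ∷ c ∷ []
  cut-a rewrite ==E-refl a = refl
  cut-b : cutAt b L ≡ c ∷ a ∷ []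
  cut-b rewrite ==E-≢ a≢b | ==E-refl b = refl
  cut-c : cutAt c L ≡ a ∷ b ∷ []
  cut-c rewrite ==E-≢ (≢-sym c≢a) | ==E-≢ b≢c | ==E-refl c = refl

rotateL-inCyclicOrder : ∀ {a b c} → Distinct a b c → ∀ k → InCyclicOrder a b c (rotateL k (a ∷ b ∷ c ∷ []))
rotateL-inCyclicOrder d                 zero    = triple-inCyclicOrder d
rotateL-inCyclicOrder (a≢b , b≢c , c≢a) (suc k) =
  inCyclicOrder-rotate (inCyclicOrder-rotate (rotateL-inCyclicOrder (b≢c , c≢a , a≢b) k))

SameOrderOn : List Edge → List Edge → List Edge → Set
SameOrderOn es L M = ∀ {e} → e ∈ es → nextIn L e ≡ nextIn M e × cutAt e L ≡ cutAt e M

sameOrderOn-resp-↭ : ∀ {es es′ L M} → es ↭ es′ → SameOrderOn es L M → SameOrderOn es′ L M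
sameOrderOn-resp-↭ p same e∈es′ = same (∈-resp-↭ (↭-sym p) e∈es′)

inCyclicOrder-sameOrder : ∀ {a b c L M} → InCyclicOrder a b c L → InCyclicOrder a b c M →
                          SameOrderOn (a ∷ b ∷ c ∷ []) L M
inCyclicOrder-sameOrder oL oM = λ where
    (here refl)                 → trans L.next-a (sym M.next-a) , trans L.cut-a (sym M.cut-a)
    (there (here refl))         → trans L.next-b (sym M.next-b) , trans L.cut-b (sym M.cut-b)
    (there (there (here refl))) → trans L.next-c (sym M.next-c) , trans L.cut-c (sym M.cut-c)
  where
  module L = InCyclicOrder oL
  module M = InCyclicOrder oM

↭-triple-orientation : ∀ {a b c L} → Distinct a b c → L ↭ a ∷ b ∷ c ∷ [] →
                       ∃ λ o → SameOrderOn (a ∷ b ∷ c ∷ []) L (oriented o (a ∷ b ∷ c ∷ []))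
↭-triple-orientation {a} {b} {c} d@(a≢b , b≢c , c≢a) p with ↭-triple-inv p
... | true  , k , refl = true , inCyclicOrder-sameOrder (rotateL-inCyclicOrder d k) (triple-inCyclicOrder d)
... | false , k , refl = false ,
  sameOrderOn-resp-↭ {L = rotateL k (a ∷ c ∷ b ∷ [])} {M = a ∷ c ∷ b ∷ []} (prep a (swap c b ↭-refl))
    (inCyclicOrder-sameOrder (rotateL-inCyclicOrder d′ k) (triple-inCyclicOrder d′))
  where
  d′ : Distinct a c b
  d′ = ≢-sym c≢a , ≢-sym b≢c , ≢-sym a≢b

-- Face tracing and contraction read a rotation only through nextIn and cutAt
-- at incident edges, so they cannot tell ≈ʳ-related rotation systems apart.
_≈ʳ_ : Rot → Rot → Set
r ≈ʳ r′ = ∀ x → SameOrderOn (incident x) (r x) (r′ x)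

≈ʳ-reflexive : ∀ {r r′} → (∀ x → r x ≡ r′ x) → r ≈ʳ r′
≈ʳ-reflexive r≡r′ x {e} _ = cong (λ L → nextIn L e) (r≡r′ x) , cong (cutAt e) (r≡r′ x)

Orientation : Set
Orientation = V → Bool

standard : Orientation → Rot
standard o x = oriented (o x) (incident x)

incident-orientation : ∀ x {L} → L ↭ incident x → ∃ λ o → SameOrderOn (incident x) L (oriented o (incident x))
incident-orientation A = ↭-triple-orientation ((λ ()) , (λ ()) , (λ ()))
incident-orientation B = ↭-triple-orientation ((λ ()) , (λ ()) , (λ ()))
incident-orientation C = ↭-triple-orientation ((λ ()) , (λ ()) , (λ ()))
incident-orientation D = ↭-triple-orientation ((λ ()) , (λ ()) , (λ ()))
incident-orientation E = ↭-triple-orientation ((λ ()) , (λ ()) , (λ ()))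
incident-orientation F = ↭-triple-orientation ((λ ()) , (λ ()) , (λ ()))

valid⇒≈standard : ∀ {rot} → ValidRot rot → ∃ λ o → rot ≈ʳ standard o
valid⇒≈standard valid = (λ x → proj₁ (incident-orientation x (valid x)))
                      , (λ x → proj₂ (incident-orientation x (valid x)))

ends-incident : ∀ e → e ∈ incident (proj₁ (ends e)) × e ∈ incident (proj₂ (ends e))
ends-incident AB = here refl                 , here refl
ends-incident AC = there (here refl)         , here refl
ends-incident AE = there (there (here refl)) , here refl
ends-incident BD = here refl                 , there (here refl)
ends-incident BF = here refl                 , there (there (here refl))
ends-incident CD = there (here refl)         , there (here refl)
ends-incident CF = there (here refl)         , there (there (here refl))
ends-incident ED = there (there (here refl)) , there (here refl)
ends-incident EF = there (there (here refl)) , there (there (here refl))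

headD-incident : ∀ d → proj₁ d ∈ incident (headD d)
headD-incident (e , true)  = proj₂ (ends-incident e)
headD-incident (e , false) = proj₁ (ends-incident e)

iter-cong : ∀ {f g : Dart → Dart} → (∀ d → f d ≡ g d) → ∀ k d → iter k f d ≡ iter k g d
iter-cong         f≗g zero    d = refl
iter-cong {f} {g} f≗g (suc k) d = trans (cong f (iter-cong f≗g k d)) (f≗g (iter k g d))

allB-cong : ∀ {p q : ℕ → Bool} → (∀ n → p n ≡ q n) → ∀ ns → allB p ns ≡ allB q ns
allB-cong p≗q []       = refl
allB-cong p≗q (n ∷ ns) = cong₂ _∧_ (p≗q n) (allB-cong p≗q ns)

filterᵇ-cong : ∀ {p q : S → Bool} → (∀ x → p x ≡ q x) → ∀ xs → filterᵇ p xs ≡ filterᵇ q xs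
filterᵇ-cong p≗q [] = refl
filterᵇ-cong {q = q} p≗q (x ∷ xs) rewrite p≗q x with q x
... | true  = cong (x ∷_) (filterᵇ-cong p≗q xs)
... | false = filterᵇ-cong p≗q xs

Counterexample : Rot → Set
Counterexample rot = TwoCellOnDoubleTorus rot × CommonRotation (contract rot CAE) (contract rot DBF)

module _ {r r′ : Rot} (r≈r′ : r ≈ʳ r′) where

  faceStep-resp : ∀ d → faceStep r d ≡ faceStep r′ d
  faceStep-resp d = cong (leaving (headD d)) (proj₁ (r≈r′ (headD d) (headD-incident d)))

  faces-resp : faces r ≡ faces r′
  faces-resp = cong length (filterᵇ-cong {p = orbitMin r} {orbitMin r′} orbitMin-resp allDarts)
    where
    orbitMin-resp : ∀ d → orbitMin r d ≡ orbitMin r′ d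
    orbitMin-resp d =
      allB-cong {λ k → dcode d ≤ᵇ dcode (iter k (faceStep r) d)} {λ k → dcode d ≤ᵇ dcode (iter k (faceStep r′) d)}
        (λ k → cong (λ d′ → dcode d ≤ᵇ dcode d′) (iter-cong faceStep-resp k d)) (upTo 18)

  cutAt-resp : ∀ x {e} → e ∈ incident x → cutAt e (r x) ≡ cutAt e (r′ x)
  cutAt-resp x e∈ = proj₂ (r≈r′ x e∈)

  contract-resp : ∀ t → contract r t ≡ contract r′ t
  contract-resp CAE = cong (mapMaybe label)
    (cong₂ _++_ (cong (cutAt AE) (cong₂ _++_ (cutAt-resp A (there (here refl))) (cutAt-resp C (here refl))))
                (cutAt-resp E (here refl)))
  contract-resp DBF = cong (mapMaybe label)
    (cong₂ _++_ (cong (cutAt BF) (cong₂ _++_ (cutAt-resp B (there (here refl))) (cutAt-resp D (here refl))))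
                (cutAt-resp F (here refl)))

  counterexample-resp : Counterexample r → Counterexample r′
  counterexample-resp (twoCell , common) =
    trans (cong (λ n → 6 + n + 2 * 2) (sym faces-resp)) twoCell ,
    subst₂ CommonRotation (contract-resp CAE) (contract-resp DBF) common

unlabel : ThE → Edge
unlabel tAB = AB
unlabel tCD = CD
unlabel tCF = CF
unlabel tED = ED
unlabel tEF = EF

label-unlabel : ∀ t → label (unlabel t) ≡ just t
label-unlabel tAB = refl
label-unlabel tCD = refl
label-unlabel tCF = refl
label-unlabel tED = refl
label-unlabel tEF = refl

unlabel-injective : ∀ {t t′} → unlabel t ≡ unlabel t′ → t ≡ t′
unlabel-injective {t} {t′} eq =
  just-injective (trans (sym (label-unlabel t)) (trans (cong label eq) (label-unlabel t′)))

_≟ᵗ_ : DecidableEquality ThE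
_≟ᵗ_ = eq? (mk↣ (unlabel-injective ∘ ecode-injective))

counterexample? : ∀ rot → Dec (Counterexample rot)
counterexample? rot =
  (6 + faces rot + 2 * 2 ≟ 9 + 2) ×-dec commonRotation? _≟ᵗ_ (contract rot CAE) (contract rot DBF)

orientation : Bool → Bool → Bool → Bool → Bool → Bool → Orientation
orientation oA _ _ _ _ _ A = oA
orientation _ oB _ _ _ _ B = oB
orientation _ _ oC _ _ _ C = oC
orientation _ _ _ oD _ _ D = oD
orientation _ _ _ _ oE _ E = oE
orientation _ _ _ _ _ oF F = oF

standard-orientation : ∀ o x →
                       standard o x ≡ standard (orientation (o A) (o B) (o C) (o D) (o E) (o F)) x
standard-orientation o A = refl
standard-orientation o B = refl
standard-orientation o C = refl
standard-orientation o D = refl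
standard-orientation o E = refl
standard-orientation o F = refl

∀-Bool? : {P : Bool → Set} → (∀ b → Dec (P b)) → Dec (∀ b → P b)
∀-Bool? P? = map′ (λ { (pt , pf) true → pt ; (pt , pf) false → pf }) (λ p → p true , p false)
                  (P? true ×-dec P? false)

no-standard-counterexample : ∀ oA oB oC oD oE oF → ¬ Counterexample (standard (orientation oA oB oC oD oE oF))
no-standard-counterexample = from-yes
  (∀-Bool? λ oA → ∀-Bool? λ oB → ∀-Bool? λ oC → ∀-Bool? λ oD → ∀-Bool? λ oE → ∀-Bool? λ oF →
   ¬? (counterexample? (standard (orientation oA oB oC oD oE oF))))

isoΘ-commonRotation : {V₁ E₁ V₂ E₂ : Set} {r₁ : V₁ → List E₁} {r₂ : V₂ → List E₂} →
                      IsoΘ r₁ r₂ → (∀ y y′ → r₂ y ≡ r₂ y′) → ∀ x x′ → CommonRotation (r₁ x) (r₁ x′)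
isoΘ-commonRotation {r₁ = r₁} {r₂} (φ , ψ , rotates) r₂-const x x′
  with rotates x | rotates x′
... | k , eq | j , eq′ = k , j , map-injective (Injection.injective (↔⇒↣ ψ)) (begin
  map to (rotateL k (r₁ x))    ≡⟨ rotateL-map to k (r₁ x) ⟨
  rotateL k (map to (r₁ x))    ≡⟨ eq ⟩
  r₂ (Inverse.to φ x)          ≡⟨ r₂-const _ _ ⟩
  r₂ (Inverse.to φ x′)         ≡⟨ eq′ ⟨
  rotateL j (map to (r₁ x′))   ≡⟨ rotateL-map to j (r₁ x′) ⟩
  map to (rotateL j (r₁ x′))   ∎)
  where
  open ≡-Reasoning
  open Inverse ψ using (to)

lemma10 : (rot : Rot) → ValidRot rot → TwoCellOnDoubleTorus rot →
    ¬ IsoΘ (contract rot) theta5-2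
lemma10 rot valid twoCell iso = no-standard-counterexample (o A) (o B) (o C) (o D) (o E) (o F) counter′
  where
  o : Orientation
  o = proj₁ (valid⇒≈standard valid)
  o′ : Orientation
  o′ = orientation (o A) (o B) (o C) (o D) (o E) (o F)
  counter : Counterexample rot
  counter = twoCell , isoΘ-commonRotation iso (λ _ _ → refl) CAE DBF
  counter′ : Counterexample (standard o′)
  counter′ = counterexample-resp {standard o} {standard o′} (≈ʳ-reflexive (standard-orientation o))
               (counterexample-resp {rot} {standard o} (proj₂ (valid⇒≈standard valid)) counter)
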